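{- Let $T(x)=c_0+c_1x+\cdots+c_nx^n\in(\mathbb{Z}/2)[x]$ have degree $n\geq1$, and let $k\geq1$. Then \[|A_1(k)\cap A_2(k)|=|A_1(k)\cap A_2(k)\cap B_1(k)|=|A_1(k)\cap A_2(k)\cap B_2(k)|=|A_1(k)\cap A_2(k)\cap B_1(k)\cap B_2(k)|=1.\]
   Context: Write $T(x)=c_0+\cdots+c_nx^n$ with $c_n\neq0$. The automaton $A_2(1;T)$ has line $r$ (for $r\geq0$) equal to $T(x)^r\in(\mathbb{Z}/2)[x]$. Each line is identified with the bi-infinite sequence $(a_j)_{j\in\mathbb{Z}}$ of its coefficients, with zeros outside the support. A string $w\in(\mathbb{Z}/2)^k$ is $k$-accessible if $w=(a_j,\dots,a_{j+k-1})$ for some line and some $j\in\mathbb{Z}$. Let $\mathscr{A}(k)$ be the set of $k$-accessible blocks. Define $A_1(k)=\{x_00x_10\cdots x_{k-1}0: x_0\cdots x_{k-1}\in\mathscr{A}(k)\}$ and $A_2(k)=\{0x_00x_1\cdots0x_{k-1}: x_0\cdots x_{k-1}\in\mathscr{A}(k)\}$, both subsets of $(\mathbb{Z}/2)^{2k}$. For $i\in\{1,2\}$ let $m_i(k)=k+\lfloor (n+i-1)/2\rfloor$. Define $T_{B_i}:(\mathbb{Z}/2)^{m_i(k)}\to(\mathbb{Z}/2)^{2k}$ by $T_{B_i}(b)=(e_{n+i-1},\dots,e_{n+2k+i-2})$. Here $e_j$ is the coefficient of $x^j$ in $x\,T(x)\,b(x^2)$, where $b(x)=\sum_lb_lx^l$.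 Put $B_i(k)=T_{B_i}(\mathscr{A}(m_i(k)))$. -}

module Defs where

open import Data.Bool using (Bool; true; false; _xor_; if_then_else_)
open import Data.List using (List; []; _∷_)
open import Data.Nat using (ℕ; zero; suc; _+_; _∸_; _/_)
open import Data.Integer as ℤ using (ℤ; +_; -[1+_])
open import Data.Fin using (Fin; toℕ)
open import Data.Vec using (Vec; []; _∷_; lookup; tabulate; toList)
open import Data.Product using (Σ; ∃; ∃-syntax; _×_; _,_)
open import Relation.Binary.PropositionalEquality using (_≡_)

-- Polynomials over ℤ/2 are lists of coefficients (Bool, true = 1),
-- lowest degree first; trailing zeros are allowed.

addP : List Bool → List Bool → List Bool
addP [] q = q
addP (a ∷ p) [] = a ∷ p
addP (a ∷ p) (b ∷ q) = (a xor b) ∷ addP p q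

mulP : List Bool → List Bool → List Bool
mulP [] q = []
mulP (a ∷ p) q = addP (if a then q else []) (false ∷ mulP p q)

powP : List Bool → ℕ → List Bool
powP p zero = true ∷ []
powP p (suc r) = mulP p (powP p r)

coeff : List Bool → ℕ → Bool
coeff [] j = false
coeff (a ∷ p) zero = a
coeff (a ∷ p) (suc j) = coeff p j

-- coefficient of x^j for j ∈ ℤ (zero for negative j): the bi-infinite line
coeffℤ : List Bool → ℤ → Bool
coeffℤ p (+ j) = coeff p j
coeffℤ p -[1+ j ] = false

spread : List Bool → List Bool
spread [] = []
spread (b ∷ bs) = b ∷ false ∷ spread bs

-- 2k, defined so that it computes nicely on Vec indices
dbl : ℕ → ℕ
dbl zero = zero
dbl (suc k) = suc (suc (dbl k))

module _ (n : ℕ) (T : Vec Bool (suc n)) where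

  Tp : List Bool
  Tp = toList T

  -- w is k-accessible for A₂(1;T): w occurs at position j of line r = T(x)^r
  Accessible : (k : ℕ) → Vec Bool k → Set
  Accessible k w =
    ∃[ r ] ∃[ j ] ((i : Fin k) → lookup w i ≡ coeffℤ (powP Tp r) (j ℤ.+ + toℕ i))

  inter₁ : {k : ℕ} → Vec Bool k → Vec Bool (dbl k)
  inter₁ [] = []
  inter₁ (x ∷ xs) = x ∷ false ∷ inter₁ xs

  inter₂ : {k : ℕ} → Vec Bool k → Vec Bool (dbl k)
  inter₂ [] = []
  inter₂ (x ∷ xs) = false ∷ x ∷ inter₂ xs

  A₁ : (k : ℕ) → Vec Bool (dbl k) → Set
  A₁ k w = ∃[ x ] (Accessible k x × w ≡ inter₁ x)

  A₂ : (k : ℕ) → Vec Bool (dbl k) → Set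
  A₂ k w = ∃[ x ] (Accessible k x × w ≡ inter₂ x)

  m : ℕ → ℕ → ℕ
  m i k = k + ((n + i ∸ 1) / 2)

  TB : (i k : ℕ) → Vec Bool (m i k) → Vec Bool (dbl k)
  TB i k b = tabulate (λ t → coeff (false ∷ mulP Tp (spread (toList b))) (n + i ∸ 1 + toℕ t))

  B : (i k : ℕ) → Vec Bool (dbl k) → Set
  B i k w = ∃[ b ] (Accessible (m i k) b × w ≡ TB i k b)

ExactlyOne : {A : Set} → (A → Set) → Set
ExactlyOne {A} P = ∃[ w ] (P w × ((v : A) → P v → v ≡ w))

module Submission where

open import Defs
open import Data.Bool using (Bool; true; false)
open import Data.Nat using (ℕ; zero; suc; _+_; _∸_; _≤_)
open import Data.Fin as Fin using (Fin; fromℕ)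
open import Data.List using (List; []; _∷_)
open import Data.Vec using (Vec; []; _∷_; lookup; replicate; tabulate; toList)
open import Data.Vec.Properties using (∷-injective; lookup-replicate)
open import Data.Integer using (+_)
open import Data.Product using (_×_; _,_)
open import Function using (_∘_)
open import Relation.Binary.PropositionalEquality using (_≡_; refl; sym; trans; cong; cong₂; module ≡-Reasoning)

-- A word lying in both A₁(k) and A₂(k) has a zero in every position, so it
-- is the zero word. Conversely the zero block is accessible, and it is sent to
-- the zero word by both interleavings and by the linear maps T_{B_i}. So each
-- of the four sets is exactly {0}.

Vanishes : List Bool → Set
Vanishes p = ∀ j → coeff p j ≡ false

vanishes-shift : ∀ p → Vanishes p → Vanishes (false ∷ p)
vanishes-shift p vp zero    = refl
vanishes-shift p vp (suc j) = vp j

addP-vanishes : ∀ p q → Vanishes p → Vanishes q → Vanishes (addP p q)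
addP-vanishes []      q       vp vq = vq
addP-vanishes (a ∷ p) []      vp vq = vp
addP-vanishes (a ∷ p) (b ∷ q) vp vq zero rewrite vp zero | vq zero = refl
addP-vanishes (a ∷ p) (b ∷ q) vp vq (suc j) = addP-vanishes p q (vp ∘ suc) (vq ∘ suc) j

mulP-vanishesʳ : ∀ p q → Vanishes q → Vanishes (mulP p q)
mulP-vanishesʳ []          q vq j = refl
mulP-vanishesʳ (true ∷ p)  q vq   =
  addP-vanishes q (false ∷ mulP p q) vq (vanishes-shift (mulP p q) (mulP-vanishesʳ p q vq))
mulP-vanishesʳ (false ∷ p) q vq   = vanishes-shift (mulP p q) (mulP-vanishesʳ p q vq)

spread-replicate-vanishes : ∀ k → Vanishes (spread (toList (replicate k false)))
spread-replicate-vanishes zero    = λ _ → refl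
spread-replicate-vanishes (suc k) =
  vanishes-shift _ (vanishes-shift _ (spread-replicate-vanishes k))

tabulate-false : ∀ {k} {f : Fin k → Bool} → (∀ t → f t ≡ false) → tabulate f ≡ replicate k false
tabulate-false {zero}  ff = refl
tabulate-false {suc k} ff = cong₂ _∷_ (ff Fin.zero) (tabulate-false (ff ∘ Fin.suc))

module _ (n : ℕ) (T : Vec Bool (suc n)) where

  -- Line 0 is the constant polynomial 1, which reads zeros from position 1 on.
  replicate-accessible : ∀ k → Accessible n T k (replicate k false)
  replicate-accessible k = 0 , + 1 , λ i → lookup-replicate i false

  inter₁-replicate : ∀ k → inter₁ n T (replicate k false) ≡ replicate (dbl k) false
  inter₁-replicate zero    = refl
  inter₁-replicate (suc k) = cong₂ _∷_ refl (cong₂ _∷_ refl (inter₁-replicate k))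

  inter₂-replicate : ∀ k → inter₂ n T (replicate k false) ≡ replicate (dbl k) false
  inter₂-replicate zero    = refl
  inter₂-replicate (suc k) = cong₂ _∷_ refl (cong₂ _∷_ refl (inter₂-replicate k))

  inter₁≡inter₂⇒replicate : ∀ {k} (x y : Vec Bool k) → inter₁ n T x ≡ inter₂ n T y → x ≡ replicate k false
  inter₁≡inter₂⇒replicate []       []       _ = refl
  inter₁≡inter₂⇒replicate (a ∷ xs) (b ∷ ys) e
    with a≡false , e′ ← ∷-injective e
    with _ , e″ ← ∷-injective e′
    = cong₂ _∷_ a≡false (inter₁≡inter₂⇒replicate xs ys e″)

  A₁∩A₂⊆replicate : ∀ {k w} → A₁ n T k w → A₂ n T k w → w ≡ replicate (dbl k) false
  A₁∩A₂⊆replicate {k} {w} (x , _ , w≡x) (y , _ , w≡y) = begin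
    w                                ≡⟨ w≡x ⟩
    inter₁ n T x                     ≡⟨ cong (inter₁ n T) x≡0 ⟩
    inter₁ n T (replicate k false)   ≡⟨ inter₁-replicate k ⟩
    replicate (dbl k) false          ∎
    where
    open ≡-Reasoning
    x≡0 : x ≡ replicate k false
    x≡0 = inter₁≡inter₂⇒replicate x y (trans (sym w≡x) w≡y)

  replicate∈A₁ : ∀ k → A₁ n T k (replicate (dbl k) false)
  replicate∈A₁ k = replicate k false , replicate-accessible k , sym (inter₁-replicate k)

  replicate∈A₂ : ∀ k → A₂ n T k (replicate (dbl k) false)
  replicate∈A₂ k = replicate k false , replicate-accessible k , sym (inter₂-replicate k)

  replicate∈B : ∀ i k → B n T i k (replicate (dbl k) false)
  replicate∈B i k = replicate (m n T i k) false , replicate-accessible (m n T i k) ,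
    sym (tabulate-false (λ t → xTb-vanishes (n + i ∸ 1 + Fin.toℕ t)))
    where
    b : List Bool
    b = spread (toList (replicate (m n T i k) false))
    xTb-vanishes : Vanishes (false ∷ mulP (Tp n T) b)
    xTb-vanishes = vanishes-shift _ (mulP-vanishesʳ (Tp n T) b (spread-replicate-vanishes (m n T i k)))

  exactlyOne-replicate : ∀ {k} {P : Vec Bool (dbl k) → Set} →
    (∀ {w} → P w → A₁ n T k w × A₂ n T k w) → P (replicate (dbl k) false) → ExactlyOne P
  exactlyOne-replicate P⊆A₁∩A₂ P0 = _ , P0 , λ w Pw → let a₁ , a₂ = P⊆A₁∩A₂ Pw in A₁∩A₂⊆replicate a₁ a₂

mainTheorem9 : (n : ℕ) (T : Vec Bool (suc n)) → 1 ≤ n → lookup T (fromℕ n) ≡ true →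
    (k : ℕ) → 1 ≤ k →
      ExactlyOne (λ w → A₁ n T k w × A₂ n T k w)
      × ExactlyOne (λ w → A₁ n T k w × A₂ n T k w × B n T 1 k w)
      × ExactlyOne (λ w → A₁ n T k w × A₂ n T k w × B n T 2 k w)
      × ExactlyOne (λ w → A₁ n T k w × A₂ n T k w × B n T 1 k w × B n T 2 k w)
mainTheorem9 n T _ _ k _ =
    exactlyOne-replicate n T (λ h → h) (a₁ , a₂)
  , exactlyOne-replicate n T (λ (x₁ , x₂ , _) → x₁ , x₂) (a₁ , a₂ , b 1)
  , exactlyOne-replicate n T (λ (x₁ , x₂ , _) → x₁ , x₂) (a₁ , a₂ , b 2)
  , exactlyOne-replicate n T (λ (x₁ , x₂ , _) → x₁ , x₂) (a₁ , a₂ , b 1 , b 2)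
  where
  a₁ : A₁ n T k (replicate (dbl k) false)
  a₁ = replicate∈A₁ n T k
  a₂ : A₂ n T k (replicate (dbl k) false)
  a₂ = replicate∈A₂ n T k
  b : ∀ i → B n T i k (replicate (dbl k) false)
  b i = replicate∈B n T i k
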